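{- Let $(M,\in)$ be an $\in$-structure with an ordered pairing structure $\langle -,-\rangle$. Then for every $x:M$ the type $\sum_{a,b:M}\langle a,b\rangle=x$ is a mere proposition.
   Context: Homotopy type theory. An $\in$-structure is a pair $(M,\in)$ with $M:\mathrm{Type}$ and $\in:M\to M\to\mathrm{Type}$ such that for all $x,y:M$ the canonical map $(x=y)\to\prod_{z:M}(z\in x)\simeq(z\in y)$ is an equivalence. An ordered pairing structure on it is a function $\langle -,-\rangle:M\to M\to M$ such that for all $a,b,a',b':M$ the canonical map $(a=a')\times(b=b')\to(\langle a,b\rangle=\langle a',b'\rangle)$ is an equivalence. -}

{-# OPTIONS --without-K #-}
module Defs where

open import Level using (Level; _⊔_; suc)
open import Data.Product using (Σ; _×_; _,_)
open import Relation.Binary.PropositionalEquality using (_≡_; refl; cong₂)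

private variable ℓ ℓ' : Level

isContr : Set ℓ → Set ℓ
isContr A = Σ A λ c → (y : A) → c ≡ y

isProp : Set ℓ → Set ℓ
isProp A = (x y : A) → x ≡ y

fiber : {A : Set ℓ} {B : Set ℓ'} → (A → B) → B → Set (ℓ ⊔ ℓ')
fiber {A = A} f b = Σ A λ a → f a ≡ b

isEquiv : {A : Set ℓ} {B : Set ℓ'} → (A → B) → Set (ℓ ⊔ ℓ')
isEquiv {B = B} f = (b : B) → isContr (fiber f b)

_≃_ : Set ℓ → Set ℓ' → Set (ℓ ⊔ ℓ')
A ≃ B = Σ (A → B) isEquiv

idIsEquiv : (A : Set ℓ) → isEquiv (λ (a : A) → a)
idIsEquiv A b = (b , refl) , λ { (a , refl) → refl }

idEquiv : (A : Set ℓ) → A ≃ A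
idEquiv A = (λ a → a) , idIsEquiv A

canonical∈ : {M : Set ℓ} (_∈_ : M → M → Set ℓ') (x y : M) →
  x ≡ y → (z : M) → (z ∈ x) ≃ (z ∈ y)
canonical∈ _∈_ x .x refl z = idEquiv (z ∈ x)

record ∈-Structure (ℓ : Level) : Set (suc ℓ) where
  field
    M   : Set ℓ
    _∈_ : M → M → Set ℓ
    extensional : (x y : M) → isEquiv (canonical∈ _∈_ x y)

pairCanonical : {M : Set ℓ} (pair : M → M → M) (a b a' b' : M) →
  (a ≡ a') × (b ≡ b') → pair a b ≡ pair a' b'
pairCanonical pair a b a' b' (p , q) = cong₂ pair p q

record OrderedPairing {ℓ : Level} (S : ∈-Structure ℓ) : Set ℓ where
  open ∈-Structure S
  field
    ⟨_,_⟩ : M → M → M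
    pairEquiv : (a b a' b' : M) → isEquiv (pairCanonical ⟨_,_⟩ a b a' b')

{-# OPTIONS --without-K #-}
module Submission where

open import Defs
open import Level using (Level)
open import Data.Product using (Σ; _,_; proj₁)
open import Relation.Binary.PropositionalEquality using (_≡_; refl; sym; trans; cong₂)
open import Relation.Binary.PropositionalEquality.Properties using (trans-reflʳ)

-- Two points (a , b , p), (a' , b' , p') of the fibre are equal once p ∙ p'⁻¹ lies in the image of
-- cong₂ ⟨_,_⟩; pairCanonical being an equivalence provides exactly that.

private variable ℓ : Level

fiber₂ : {M : Set ℓ} → (M → M → M) → M → Set ℓ
fiber₂ {M = M} pr x = Σ M λ a → Σ M λ b → pr a b ≡ x

fiber₂-path : {M : Set ℓ} (pr : M → M → M) {x a b a' b' : M}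
  (p : pr a b ≡ x) (p' : pr a' b' ≡ x) (r : a ≡ a') (s : b ≡ b') →
  cong₂ pr r s ≡ trans p (sym p') →
  _≡_ {A = fiber₂ pr x} (a , b , p) (a' , b' , p')
fiber₂-path pr p refl refl refl e
  with trans e (trans-reflʳ p)
... | refl = refl

fiber₂-isProp : {M : Set ℓ} (pr : M → M → M) →
  (∀ a b a' b' (q : pr a b ≡ pr a' b') → Σ (a ≡ a') λ r → Σ (b ≡ b') λ s → cong₂ pr r s ≡ q) →
  (x : M) → isProp (fiber₂ pr x)
fiber₂-isProp pr cong₂-surjective x (a , b , p) (a' , b' , p')
  with cong₂-surjective a b a' b' (trans p (sym p'))
... | r , s , e = fiber₂-path pr p p' r s e

pairCanonical-surjective : {S : ∈-Structure ℓ} (P : OrderedPairing S) →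
  let open ∈-Structure S; open OrderedPairing P in
  ∀ a b a' b' (q : ⟨ a , b ⟩ ≡ ⟨ a' , b' ⟩) →
  Σ (a ≡ a') λ r → Σ (b ≡ b') λ s → cong₂ ⟨_,_⟩ r s ≡ q
pairCanonical-surjective P a b a' b' q
  with proj₁ (OrderedPairing.pairEquiv P a b a' b' q)
... | (r , s) , e = r , s , e

mainTheorem13 : {ℓ : Level} (S : ∈-Structure ℓ) (P : OrderedPairing S) →
    (x : ∈-Structure.M S) →
      isProp (Σ (∈-Structure.M S) λ a → Σ (∈-Structure.M S) λ b →
        OrderedPairing.⟨_,_⟩ P a b ≡ x)
mainTheorem13 S P = fiber₂-isProp (OrderedPairing.⟨_,_⟩ P) (pairCanonical-surjective P)
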